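{- Let $P$ be a decreasing tableau, $(r,c)$ a removable cell of $P$, and $m_r<\dots<m_1$ the bumping path of $(r,c)$ in $P$. Then $m_1$ is $P$-ejectable.
   Context: Tableaux use English notation; cell $(i,j)$ is in row $i$, column $j$. A decreasing tableau is a filling of the diagram of a partition by positive integers strictly decreasing from left to right along rows and from top to bottom along columns. A cell is removable if it is the last cell of its row and the bottom cell of its column. $P_{>r}$ denotes the tableau obtained by deleting the first $r$ rows of $P$. A value $x$ is $P$-ejectable if $x$ occurs in the first row of $P$ and either $x-1$ does not occur in the first row, or $x-1$ occurs in the first row and $x-1$ is $P_{>1}$-ejectable (nothing is ejectable in the empty tableau). Bumping path of a removable cell $(r,c)$ of $P$: $m_r$ is the entry at $(r,c)$, and for $i=r-1,\dots,1$, $m_i$ is the smallest entry of row $i$ of $P$ with $m_i>m_{i+1}$. -}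

module Defs where

open import Data.Nat using (ℕ; zero; suc; _<_; _≤_; _∸_)
open import Data.List using (List; []; _∷_; length)
open import Data.List.Relation.Unary.All using (All)
open import Data.List.Relation.Unary.Linked using (Linked)
open import Data.List.Membership.Propositional using (_∈_; _∉_)
open import Data.Maybe using (Maybe; just; nothing)
open import Data.Product using (_×_)
open import Data.Sum using (_⊎_)
open import Data.Unit using (⊤)
open import Data.Empty using (⊥)
open import Relation.Binary.PropositionalEquality using (_≡_; _≢_)

-- A tableau is the list of its rows (top row first), each row read left to right.
Tableau : Set
Tableau = List (List ℕ)

-- Row i of P, 1-indexed ([] if i = 0 or i exceeds the number of rows).
rowAt : Tableau → ℕ → List ℕ
rowAt []      _             = []
rowAt (R ∷ P) zero          = []
rowAt (R ∷ P) (suc zero)    = R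
rowAt (R ∷ P) (suc (suc i)) = rowAt P (suc i)

entryAt : List ℕ → ℕ → Maybe ℕ
entryAt []      _             = nothing
entryAt (x ∷ R) zero          = nothing
entryAt (x ∷ R) (suc zero)    = just x
entryAt (x ∷ R) (suc (suc j)) = entryAt R (suc j)

entry : Tableau → ℕ → ℕ → Maybe ℕ
entry P i j = entryAt (rowAt P i) j

-- Column condition between consecutive rows R (above) and R' (below):
-- R' is no longer than R and each entry of R' is smaller than the entry above it.
Above : List ℕ → List ℕ → Set
Above _        []        = ⊤
Above []       (_ ∷ _)   = ⊥
Above (a ∷ as) (b ∷ bs)  = (b < a) × Above as bs

GoodRow : List ℕ → Set
GoodRow R = (R ≢ []) × Linked (λ x y → y < x) R × All (λ x → 0 < x) R

Decreasing : Tableau → Set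
Decreasing P = All GoodRow P × Linked Above P

-- (r,c) is a removable cell of P: it is a cell, it is the last cell of row r,
-- and row r+1 has fewer than c cells (so it is the bottom cell of column c).
Removable : Tableau → ℕ → ℕ → Set
Removable P r c = (1 ≤ r) × (1 ≤ c) × (c ≡ length (rowAt P r)) × (length (rowAt P (suc r)) < c)

-- P-ejectable values; the tail of the row list is P_{>1}.
Ejectable : Tableau → ℕ → Set
Ejectable []      x = ⊥
Ejectable (R ∷ P) x = (x ∈ R) × ((x ∸ 1 ∉ R) ⊎ ((x ∸ 1 ∈ R) × Ejectable P (x ∸ 1)))

SmallestAbove : List ℕ → ℕ → ℕ → Set
SmallestAbove R m y = (y ∈ R) × (m < y) × (∀ {z} → z ∈ R → m < z → y ≤ z)

-- BumpVal P r c i m : the i-th term m_i of the bumping path of (r,c) in P is m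
-- (defined for 1 ≤ i ≤ r).
data BumpVal (P : Tableau) (r c : ℕ) : ℕ → ℕ → Set where
  start : ∀ {m} → entry P r c ≡ just m → BumpVal P r c r m
  step  : ∀ {i m' m} → 1 ≤ i → BumpVal P r c (suc i) m' →
          SmallestAbove (rowAt P i) m' m → BumpVal P r c i m

-- Induction along the bumping path from row r up to row 1 shows that each m_i is
-- ejectable in P_{>i-1}. The base value m_r is the smallest entry of its row and
-- positive, so m_r - 1 is not in row r. For i < r, if m_i - 1 occurs in row i then
-- m_{i+1} ≤ m_i - 1 < m_i, and minimality of m_i forces m_i - 1 = m_{i+1}, which is
-- ejectable in P_{>i} by induction.
module Submission where

open import Data.Nat using (ℕ; zero; suc; _<_; _≤_; _≰_; _∸_)
open import Data.Nat.Properties using (≤-refl; ≤-trans; <⇒≤; n≮n; ≤-antisym; ≮⇒≥; <⇒≤pred; _≟_)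
open import Data.List using (_∷_; length; drop)
open import Data.List.Relation.Unary.All using (All)
import Data.List.Relation.Unary.All as All
open import Data.List.Relation.Unary.Any using (here; there)
open import Data.List.Relation.Unary.Linked using (Linked; [-]; _∷_)
open import Data.List.Membership.Propositional using (_∈_; _∉_)
open import Data.List.Membership.DecPropositional _≟_ using (_∈?_)
open import Data.Maybe using (just)
open import Data.Product using (_,_)
open import Data.Sum using (inj₁; inj₂)
open import Relation.Nullary using (yes; no; contradiction)
open import Relation.Binary.PropositionalEquality using (_≡_; refl; sym; subst)
open import Defs

∸1-≰ : ∀ {k m} → k < m → m ≰ m ∸ 1
∸1-≰ {m = suc m} _ = n≮n m

entryAt-∈ : ∀ R j {m} → entryAt R j ≡ just m → m ∈ R
entryAt-∈ (x ∷ R) (suc zero)    refl = here refl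
entryAt-∈ (x ∷ R) (suc (suc j)) e    = there (entryAt-∈ R (suc j) e)

last-≤ : ∀ {R m z} → Linked (λ x y → y < x) R → entryAt R (length R) ≡ just m → z ∈ R → m ≤ z
last-≤ [-]       refl (here refl) = ≤-refl
last-≤ (y<x ∷ l) e    (here refl) = ≤-trans (last-≤ l e (here refl)) (<⇒≤ y<x)
last-≤ (_   ∷ l) e    (there z∈R) = last-≤ l e z∈R

last∸1∉ : ∀ {R m} → GoodRow R → entryAt R (length R) ≡ just m → m ∸ 1 ∉ R
last∸1∉ {R} (_ , decreasing , positive) e m∸1∈R =
  ∸1-≰ (All.lookup positive (entryAt-∈ R (length R) e)) (last-≤ decreasing e m∸1∈R)

smallestAbove-∸1 : ∀ {R m′ m} → SmallestAbove R m′ m → m ∸ 1 ∈ R → m ∸ 1 ≡ m′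
smallestAbove-∸1 (_ , m′<m , minimal) m∸1∈R =
  ≤-antisym (≮⇒≥ λ m′<m∸1 → ∸1-≰ m′<m (minimal m∸1∈R m′<m∸1)) (<⇒≤pred m′<m)

∈-rowAt⇒∈ : ∀ P i {x} → x ∈ rowAt P i → rowAt P i ∈ P
∈-rowAt⇒∈ (R ∷ P) (suc zero)    _    = here refl
∈-rowAt⇒∈ (R ∷ P) (suc (suc i)) x∈Ri = there (∈-rowAt⇒∈ P (suc i) x∈Ri)

∈-rowAt⇒drop : ∀ P i {x} → x ∈ rowAt P i → drop (i ∸ 1) P ≡ rowAt P i ∷ drop i P
∈-rowAt⇒drop (R ∷ P) (suc zero)    _    = refl
∈-rowAt⇒drop (R ∷ P) (suc (suc i)) x∈Ri = ∈-rowAt⇒drop P (suc i) x∈Ri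

ejectable-∷ : ∀ {R P x} → x ∈ R → (x ∸ 1 ∈ R → Ejectable P (x ∸ 1)) → Ejectable (R ∷ P) x
ejectable-∷ {R} {x = x} x∈R below with x ∸ 1 ∈? R
... | no  x∸1∉R = x∈R , inj₁ x∸1∉R
... | yes x∸1∈R = x∈R , inj₂ (x∸1∈R , below x∸1∈R)

ejectable-rowAt : ∀ P i {x} → x ∈ rowAt P i →
                  (x ∸ 1 ∈ rowAt P i → Ejectable (drop i P) (x ∸ 1)) → Ejectable (drop (i ∸ 1) P) x
ejectable-rowAt P i x∈Ri below rewrite ∈-rowAt⇒drop P i x∈Ri = ejectable-∷ x∈Ri below

bumpVal-∈ : ∀ {P r c i m} → BumpVal P r c i m → m ∈ rowAt P i
bumpVal-∈ {P} {r} {c} (start e)            = entryAt-∈ (rowAt P r) c e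
bumpVal-∈             (step _ _ (m∈Ri , _)) = m∈Ri

module _ {P r c} (rows : All GoodRow P) (last : c ≡ length (rowAt P r)) where

  bumpVal-ejectable : ∀ {i m} → BumpVal P r c i m → Ejectable (drop (i ∸ 1) P) m
  bumpVal-ejectable {m = m} b@(start e) = ejectable-rowAt P r (bumpVal-∈ b) λ m∸1∈Rr →
    contradiction m∸1∈Rr
      (last∸1∉ (All.lookup rows (∈-rowAt⇒∈ P r m∸1∈Rr)) (subst (λ j → entryAt (rowAt P r) j ≡ just m) last e))
  bumpVal-ejectable {i} b@(step _ b′ above) = ejectable-rowAt P i (bumpVal-∈ b) λ m∸1∈Ri →
    subst (Ejectable (drop i P)) (sym (smallestAbove-∸1 above m∸1∈Ri)) (bumpVal-ejectable b′)

lemma2p7 : (P : Tableau) (r c m₁ : ℕ) → Decreasing P → Removable P r c →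
           BumpVal P r c 1 m₁ → Ejectable P m₁
lemma2p7 P r c m₁ (rows , _) (_ , _ , last , _) = bumpVal-ejectable rows last
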